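{- Let $G$ be an almost hypocyclic graph with exceptional vertex $w$, and let $(W,X)$ be a partition of the vertex set of $G$ with $|W| > 1$ and $|X| > 1$ such that $W$ is an independent set. For a vertex $v \in X$, let $n_1$ and $n_2$ denote the number of vertices of $X - v$ joined to exactly one, respectively to more than one, vertex of $W$. Then $2n_2 + n_1 \ge 2|W|$ for every $v \in X$.
   Context: Graphs are finite, simple, undirected. A graph is hamiltonian if it has a cycle through all vertices. A graph $G$ is almost hypocyclic if there is a vertex $w$ (the exceptional vertex) such that $G - w$ is non-hamiltonian but $G - v$ is hamiltonian for every vertex $v \ne w$. -}

module Defs where

open import Data.Nat using (ℕ; zero; suc; _+_; _*_; _≤_; _<_)
open import Data.Fin using (Fin; toℕ)
open import Data.Bool using (Bool; true; false; if_then_else_; not)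
open import Data.List using (List; map; allFin)
open import Data.Nat.ListAction using (sum)
open import Data.Product using (Σ; _×_; ∃-syntax)
open import Relation.Binary.PropositionalEquality using (_≡_; _≢_)
open import Relation.Nullary using (¬_)
open import Function.Definitions using (Injective)

record Graph (n : ℕ) : Set where
  field
    adj   : Fin n → Fin n → Bool
    sym   : ∀ u v → adj u v ≡ adj v u
    irref : ∀ u → adj u u ≡ false
open Graph public

-- G - v is hamiltonian: a cycle (length k ≥ 3, vertices c 0,…,c (k-1), pairwise distinct)
-- in G avoiding v and passing through every vertex other than v.
HamiltonianMinus : {n : ℕ} → Graph n → Fin n → Set
HamiltonianMinus {n} G v =
  Σ ℕ λ k → Σ (Fin k → Fin n) λ c →
    (3 ≤ k)
  × Injective _≡_ _≡_ c
  × (∀ i → c i ≢ v)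
  × (∀ u → u ≢ v → ∃[ i ] c i ≡ u)
  × (∀ (i j : Fin k) → suc (toℕ i) ≡ toℕ j → adj G (c i) (c j) ≡ true)
  × (∀ (i j : Fin k) → suc (toℕ i) ≡ k → toℕ j ≡ 0 → adj G (c i) (c j) ≡ true)

AlmostHypocyclic : {n : ℕ} → Graph n → Fin n → Set
AlmostHypocyclic G w = ¬ HamiltonianMinus G w × (∀ v → v ≢ w → HamiltonianMinus G v)

count : {n : ℕ} → (Fin n → Bool) → ℕ
count {n} p = sum (map (λ i → if p i then 1 else 0) (allFin n))

degIn : {n : ℕ} → Graph n → (Fin n → Bool) → Fin n → ℕ
degIn G W x = count (λ y → if W y then adj G x y else false)

Independent : {n : ℕ} → Graph n → (Fin n → Bool) → Set
Independent G W = ∀ u v → W u ≡ true → W v ≡ true → adj G u v ≡ false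

isOther : {n : ℕ} → Fin n → Fin n → Bool
isOther v x = not (toℕ v Data.Nat.≡ᵇ toℕ x)

n₁ : {n : ℕ} → Graph n → (Fin n → Bool) → Fin n → ℕ
n₁ G W v = count (λ x → if W x then false else
                          if isOther v x then (degIn G W x Data.Nat.≡ᵇ 1) else false)

n₂ : {n : ℕ} → Graph n → (Fin n → Bool) → Fin n → ℕ
n₂ G W v = count (λ x → if W x then false else
                          if isOther v x then (2 Data.Nat.≤ᵇ degIn G W x) else false)

-- Let C be a hamiltonian cycle of G - v for some v ∈ X. Each u ∈ W lies on C and both of its
-- C-neighbours lie in X - v, while a vertex x ∈ X - v is a C-neighbour of at most min(2, d(x))
-- vertices of W, where d(x) is the number of neighbours of x in W. Counting the edges of C between
-- W and X - v gives 2|W| ≤ Σ_{x ∈ X-v} min(2, d(x)) = 2n₂(v) + n₁(v). This settles v ≠ w.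
-- For v = w, removing w from the sum loses min(2, d(w)): if some y ∈ X - w has d(y) ≥ 2, then
-- 2n₂(y) + n₁(y) ≤ 2n₂(w) + n₁(w). Otherwise d(x) ≤ 1 on X - w, and counting all edges between
-- W and X - w works, since every u ∈ W has two neighbours other than w: a hamiltonian cycle of
-- G - y, for any y ∈ X - w, gives a neighbour r ≠ w, and a cycle of G - r gives a second one.
module Submission where

open import Defs hiding (sym)
open import Data.Bool using (Bool; true; false; if_then_else_; not; _∧_)
import Data.Bool.Properties as Bool
open import Data.Empty using (⊥; ⊥-elim)
open import Data.Fin using (Fin; zero; suc; toℕ; fromℕ; fromℕ<)
open import Data.Fin.Properties using (_≟_; any?; toℕ-injective; toℕ<n; toℕ-fromℕ; toℕ-fromℕ<)
open import Data.List using (tabulate)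
open import Data.List.Properties using (map-tabulate)
import Data.Nat.ListAction as ListAction
open import Data.Nat using (ℕ; zero; suc; _+_; _*_; _⊓_; _≤_; _<_; _≤ᵇ_; _≡ᵇ_; z≤n; s≤s)
open import Data.Nat.Properties
  using (≤-refl; ≤-trans; ≤-reflexive; ≤-antisym; <⇒≤; ≰⇒>; ≮⇒≥; <-irrefl; <⇒≱;
         +-mono-≤; +-monoˡ-≤; +-monoʳ-≤; +-cancelʳ-≤; +-comm; +-assoc; m≤n+m; ⊓-glb; m⊓n≤m;
         m≤n⇒m⊓n≡m; suc-injective)
import Data.Nat.Properties as ℕ
open import Algebra.Properties.Semiring.Sum ℕ.+-*-semiring
  using (sum; sum-syntax; sum-cong-≗; sum-replicate-zero; ∑-distrib-+; ∑-comm; *-distribˡ-sum)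
open import Data.Product using (∃; ∃₂; _×_; _,_; proj₁; proj₂)
open import Data.Sum using (_⊎_; inj₁; inj₂)
open import Function.Definitions using (Injective)
open import Relation.Binary.PropositionalEquality
open import Relation.Nullary using (Dec; yes; no; does)
open import Relation.Nullary.Decidable using (_×-dec_; _⊎-dec_; ¬?; dec-true; dec-false)

private
  variable
    m n : ℕ

-- Counting over Fin n

𝟙 : Bool → ℕ
𝟙 b = if b then 1 else 0

sum-tabulate : (f : Fin n → ℕ) → ListAction.sum (tabulate f) ≡ sum f
sum-tabulate {zero}  f = refl
sum-tabulate {suc n} f = cong (f zero +_) (sum-tabulate (λ i → f (suc i)))

count≡∑ : (p : Fin n → Bool) → count p ≡ ∑[ x < n ] 𝟙 (p x)
count≡∑ p = trans (cong ListAction.sum (map-tabulate (λ x → x) (λ x → 𝟙 (p x)))) (sum-tabulate (λ x → 𝟙 (p x)))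

∑-mono-≤ : {f g : Fin n → ℕ} → (∀ i → f i ≤ g i) → sum f ≤ sum g
∑-mono-≤ {zero}  f≤g = z≤n
∑-mono-≤ {suc n} f≤g = +-mono-≤ (f≤g zero) (∑-mono-≤ (λ i → f≤g (suc i)))

∑-punctured : (f : Fin n → ℕ) (a : Fin n) →
              ∑[ x < n ] (if isOther a x then f x else 0) + f a ≡ sum f
∑-punctured {suc n} f zero    = +-comm _ (f zero)
∑-punctured {suc n} f (suc a) =
  trans (+-assoc (f zero) _ (f (suc a))) (cong (f zero +_) (∑-punctured (λ x → f (suc x)) a))

double-counting : (R : Fin m → Fin n → Bool) →
                  ∑[ u < m ] count (R u) ≡ ∑[ x < n ] count (λ u → R u x)
double-counting {m} {n} R = begin
  ∑[ u < m ] count (R u)                   ≡⟨ sum-cong-≗ (λ u → count≡∑ (R u)) ⟩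
  ∑[ u < m ] ∑[ x < n ] 𝟙 (R u x)          ≡⟨ ∑-comm (λ u x → 𝟙 (R u x)) ⟩
  ∑[ x < n ] ∑[ u < m ] 𝟙 (R u x)          ≡⟨ sum-cong-≗ (λ x → count≡∑ (λ u → R u x)) ⟨
  ∑[ x < n ] count (λ u → R u x)           ∎
  where open ≡-Reasoning

isOther-≟ : (a x : Fin n) → isOther a x ≡ not (does (a ≟ x))
isOther-≟ zero    zero    = refl
isOther-≟ zero    (suc x) = refl
isOther-≟ (suc a) zero    = refl
isOther-≟ (suc a) (suc x) = isOther-≟ a x

isOther-self : (a : Fin n) → isOther a a ≡ false
isOther-self a = trans (isOther-≟ a a) (cong not (dec-true (a ≟ a) refl))

isOther-≢ : {a x : Fin n} → a ≢ x → isOther a x ≡ true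
isOther-≢ {a = a} {x} a≢x = trans (isOther-≟ a x) (cong not (dec-false (a ≟ x) a≢x))

isOther⇒≢ : {a x : Fin n} → isOther a x ≡ true → x ≢ a
isOther⇒≢ {a = a} other refl with () ← trans (sym other) (isOther-self a)

isOther-false⇒≡ : {a x : Fin n} → isOther a x ≡ false → a ≡ x
isOther-false⇒≡ {a = a} {x} same with a ≟ x
... | yes a≡x = a≡x
... | no  a≢x with () ← trans (sym same) (isOther-≢ a≢x)

count-punctured : (p : Fin n → Bool) (a : Fin n) →
                  count p ≡ count (λ x → isOther a x ∧ p x) + 𝟙 (p a)
count-punctured {n} p a = begin
  count p                                                   ≡⟨ count≡∑ p ⟩
  ∑[ x < n ] 𝟙 (p x)                                        ≡⟨ ∑-punctured (λ x → 𝟙 (p x)) a ⟨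
  ∑[ x < n ] (if isOther a x then 𝟙 (p x) else 0) + 𝟙 (p a) ≡⟨ cong (_+ 𝟙 (p a)) (sum-cong-≗ 𝟙-∧) ⟩
  ∑[ x < n ] 𝟙 (isOther a x ∧ p x) + 𝟙 (p a)                ≡⟨ cong (_+ 𝟙 (p a)) (count≡∑ (λ x → isOther a x ∧ p x)) ⟨
  count (λ x → isOther a x ∧ p x) + 𝟙 (p a)                 ∎
  where
  open ≡-Reasoning
  𝟙-∧ : ∀ x → (if isOther a x then 𝟙 (p x) else 0) ≡ 𝟙 (isOther a x ∧ p x)
  𝟙-∧ x with isOther a x
  ... | true  = refl
  ... | false = refl

count-none : (p : Fin n → Bool) → (∀ x → p x ≡ false) → count p ≡ 0
count-none {n} p none =
  trans (count≡∑ p) (trans (sum-cong-≗ (λ x → cong 𝟙 (none x))) (sum-replicate-zero n))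

count-mono : (p q : Fin n → Bool) → (∀ x → p x ≡ true → q x ≡ true) → count p ≤ count q
count-mono p q p⇒q = subst₂ _≤_ (sym (count≡∑ p)) (sym (count≡∑ q)) (∑-mono-≤ 𝟙-mono)
  where
  𝟙-mono : ∀ x → 𝟙 (p x) ≤ 𝟙 (q x)
  𝟙-mono x with p x in px
  ... | false = z≤n
  ... | true  rewrite p⇒q x px = ≤-refl

𝟙≤1 : (b : Bool) → 𝟙 b ≤ 1
𝟙≤1 true  = ≤-refl
𝟙≤1 false = z≤n

count-≤1 : (p : Fin n → Bool) (a : Fin n) → (∀ x → p x ≡ true → x ≡ a) → count p ≤ 1
count-≤1 p a only-a = subst (_≤ 1) (sym (count-punctured p a))
  (subst (λ k → k + 𝟙 (p a) ≤ 1) (sym (count-none _ off-a)) (𝟙≤1 (p a)))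
  where
  off-a : ∀ x → (isOther a x ∧ p x) ≡ false
  off-a x with p x in px
  ... | false = Bool.∧-zeroʳ (isOther a x)
  ... | true  rewrite only-a x px = cong (_∧ true) (isOther-self a)

count-≤2 : (p : Fin n → Bool) (a b : Fin n) → (∀ x → p x ≡ true → x ≡ a ⊎ x ≡ b) → count p ≤ 2
count-≤2 p a b only-ab = subst (_≤ 2) (sym (count-punctured p a))
  (+-mono-≤ (count-≤1 _ b only-b) (𝟙≤1 (p a)))
  where
  only-b : ∀ x → (isOther a x ∧ p x) ≡ true → x ≡ b
  only-b x h with isOther a x in other
  ... | true with only-ab x h
  ...   | inj₁ x≡a = ⊥-elim (isOther⇒≢ other x≡a)
  ...   | inj₂ x≡b = x≡b

count-≥1 : (p : Fin n → Bool) (a : Fin n) → p a ≡ true → 1 ≤ count p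
count-≥1 p a pa rewrite count-punctured p a | pa = m≤n+m 1 _

count-≥2 : (p : Fin n → Bool) (a b : Fin n) → a ≢ b → p a ≡ true → p b ≡ true → 2 ≤ count p
count-≥2 p a b a≢b pa pb rewrite count-punctured p a | pa =
  +-monoˡ-≤ 1 (count-≥1 (λ x → isOther a x ∧ p x) b (trans (cong (_∧ p b) (isOther-≢ a≢b)) pb))

exists-other : (p : Fin n → Bool) → 1 < count p → (a : Fin n) → ∃ λ y → y ≢ a × p y ≡ true
exists-other p 1<count a with any? (λ y → ¬? (y ≟ a) ×-dec (p y Bool.≟ true))
... | yes found = found
... | no  none  = ⊥-elim (<⇒≱ 1<count (count-≤1 p a only-a))
  where
  only-a : ∀ x → p x ≡ true → x ≡ a
  only-a x px with x ≟ a
  ... | yes x≡a = x≡a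
  ... | no  x≢a = ⊥-elim (none (x , x≢a , px))

-- Positions on a cycle

Consecutive : {k : ℕ} → Fin k → Fin k → Set
Consecutive {k} i j = suc (toℕ i) ≡ toℕ j ⊎ (suc (toℕ i) ≡ k × toℕ j ≡ 0)

consecutive? : {k : ℕ} (i j : Fin k) → Dec (Consecutive i j)
consecutive? {k} i j =
  (suc (toℕ i) ℕ.≟ toℕ j) ⊎-dec ((suc (toℕ i) ℕ.≟ k) ×-dec (toℕ j ℕ.≟ 0))

successor : {k : ℕ} (i : Fin k) → ∃ (Consecutive i)
successor {suc m} i with suc (toℕ i) ℕ.<? suc m
... | yes i+1<k = fromℕ< i+1<k , inj₁ (sym (toℕ-fromℕ< i+1<k))
... | no  i+1≮k = zero , inj₂ (≤-antisym (toℕ<n i) (≮⇒≥ i+1≮k) , refl)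

predecessor : {k : ℕ} (j : Fin k) → ∃ λ i → Consecutive i j
predecessor {suc m} j with toℕ j in j≡
... | zero  = fromℕ m , inj₂ (cong suc (toℕ-fromℕ m) , refl)
... | suc t = fromℕ< t<k , inj₁ (cong suc (toℕ-fromℕ< t<k))
  where
  t<k : t < suc m
  t<k = <⇒≤ (subst (_< suc m) j≡ (toℕ<n j))

successor-unique : {k : ℕ} {i j j′ : Fin k} → Consecutive i j → Consecutive i j′ → j ≡ j′
successor-unique            (inj₁ p)       (inj₁ q)       = toℕ-injective (trans (sym p) q)
successor-unique {j = j}    (inj₁ p)       (inj₂ (q , _)) = ⊥-elim (<-irrefl (trans (sym p) q) (toℕ<n j))
successor-unique {j′ = j′}  (inj₂ (p , _)) (inj₁ q)       = ⊥-elim (<-irrefl (trans (sym q) p) (toℕ<n j′))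
successor-unique            (inj₂ (_ , p)) (inj₂ (_ , q)) = toℕ-injective (trans p (sym q))

predecessor-unique : {k : ℕ} {i i′ j : Fin k} → Consecutive i j → Consecutive i′ j → i ≡ i′
predecessor-unique (inj₁ p)       (inj₁ q)       = toℕ-injective (suc-injective (trans p (sym q)))
predecessor-unique (inj₁ p)       (inj₂ (_ , q)) with () ← trans p q
predecessor-unique (inj₂ (_ , p)) (inj₁ q)       with () ← trans q p
predecessor-unique (inj₂ (p , _)) (inj₂ (q , _)) = toℕ-injective (suc-injective (trans p (sym q)))

consecutive-asym : {k : ℕ} {i j : Fin k} → 3 ≤ k → Consecutive i j → Consecutive j i → ⊥
consecutive-asym {i = i} _ (inj₁ p) (inj₁ q) = ℕ.m≢1+n+m (toℕ i) (sym (trans (cong suc p) q))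
consecutive-asym 3≤k (inj₁ p) (inj₂ (q , r)) =
  <⇒≱ 3≤k (≤-reflexive (trans (sym q) (cong suc (trans (sym p) (cong suc r)))))
consecutive-asym 3≤k (inj₂ (q , r)) (inj₁ p) =
  <⇒≱ 3≤k (≤-reflexive (trans (sym q) (cong suc (trans (sym p) (cong suc r)))))
consecutive-asym 3≤k (inj₂ (_ , r)) (inj₂ (q , _)) =
  <⇒≱ 3≤k (≤-trans (≤-reflexive (trans (sym q) (cong suc r))) (s≤s z≤n))

-- 2-factors of G - v

record TwoFactorMinus (G : Graph n) (v : Fin n) : Set where
  field
    link              : Fin n → Fin n → Bool
    link-sym          : ∀ {u x} → link u x ≡ true → link x u ≡ true
    link⇒adj          : ∀ {u x} → link u x ≡ true → adj G u x ≡ true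
    link-avoids       : ∀ {u x} → link u x ≡ true → x ≢ v
    two-links         : ∀ u → u ≢ v → ∃₂ λ p q → p ≢ q × link u p ≡ true × link u q ≡ true
    at-most-two-links : ∀ u → u ≢ v → count (link u) ≤ 2

module CycleLinks {G : Graph n} {v : Fin n} {k : ℕ} (c : Fin k → Fin n) (3≤k : 3 ≤ k)
  (c-injective : Injective _≡_ _≡_ c) (avoids : ∀ i → c i ≢ v)
  (covers : ∀ u → u ≢ v → ∃ λ i → c i ≡ u)
  (steps : ∀ {i j} → Consecutive i j → adj G (c i) (c j) ≡ true) where

  CycleEdge : Fin n → Fin n → Set
  CycleEdge u x = ∃₂ λ i j → c i ≡ u × c j ≡ x × (Consecutive i j ⊎ Consecutive j i)

  cycleEdge? : ∀ u x → Dec (CycleEdge u x)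
  cycleEdge? u x = any? λ i → any? λ j →
    (c i ≟ u) ×-dec (c j ≟ x) ×-dec (consecutive? i j ⊎-dec consecutive? j i)

  link : Fin n → Fin n → Bool
  link u x = does (cycleEdge? u x)

  from-link : ∀ {u x} → link u x ≡ true → CycleEdge u x
  from-link {u} {x} h with cycleEdge? u x
  ... | yes edge = edge

  to-link : ∀ {u x} → CycleEdge u x → link u x ≡ true
  to-link {u} {x} = dec-true (cycleEdge? u x)

  distinct-neighbours : ∀ {i a b} → Consecutive i a → Consecutive b i → c a ≢ c b
  distinct-neighbours i→a b→i ca≡cb =
    consecutive-asym 3≤k i→a (subst (λ z → Consecutive z _) (sym (c-injective ca≡cb)) b→i)

  twoFactor : TwoFactorMinus G v
  twoFactor = record
    { link              = link
    ; link-sym          = λ h → to-link (flip-edge (from-link h))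
    ; link⇒adj          = λ h → edge⇒adj (from-link h)
    ; link-avoids       = λ h → edge-avoids (from-link h)
    ; two-links         = two-links
    ; at-most-two-links = at-most-two-links
    }
    where
    flip-edge : ∀ {u x} → CycleEdge u x → CycleEdge x u
    flip-edge (i , j , ci , cj , inj₁ i→j) = j , i , cj , ci , inj₂ i→j
    flip-edge (i , j , ci , cj , inj₂ j→i) = j , i , cj , ci , inj₁ j→i

    edge⇒adj : ∀ {u x} → CycleEdge u x → adj G u x ≡ true
    edge⇒adj (i , j , refl , refl , inj₁ i→j) = steps i→j
    edge⇒adj (i , j , refl , refl , inj₂ j→i) = trans (Graph.sym G (c i) (c j)) (steps j→i)

    edge-avoids : ∀ {u x} → CycleEdge u x → x ≢ v
    edge-avoids (_ , j , _ , refl , _) = avoids j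

    two-links : ∀ u → u ≢ v → ∃₂ λ p q → p ≢ q × link u p ≡ true × link u q ≡ true
    two-links u u≢v with covers u u≢v
    ... | i , refl with successor i | predecessor i
    ... | a , i→a | b , b→i = c a , c b , distinct-neighbours i→a b→i ,
                              to-link (i , a , refl , refl , inj₁ i→a) ,
                              to-link (i , b , refl , refl , inj₂ b→i)

    at-most-two-links : ∀ u → u ≢ v → count (link u) ≤ 2
    at-most-two-links u u≢v with covers u u≢v
    ... | i , refl with successor i | predecessor i
    ... | a , i→a | b , b→i = count-≤2 (link (c i)) (c a) (c b) neighbour
      where
      neighbour : ∀ x → link (c i) x ≡ true → x ≡ c a ⊎ x ≡ c b
      neighbour x h with from-link h
      ... | i′ , j , ci′≡ci , refl , orientation with c-injective ci′≡ci
      ... | refl with orientation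
      ...   | inj₁ i→j = inj₁ (cong c (successor-unique i→j i→a))
      ...   | inj₂ j→i = inj₂ (cong c (predecessor-unique j→i b→i))

hamiltonian⇒twoFactor : {G : Graph n} {v : Fin n} → HamiltonianMinus G v → TwoFactorMinus G v
hamiltonian⇒twoFactor {G = G} (k , c , 3≤k , c-injective , avoids , covers , step , wrap) =
  CycleLinks.twoFactor c 3≤k c-injective avoids covers steps
  where
  steps : ∀ {i j} → Consecutive i j → adj G (c i) (c j) ≡ true
  steps (inj₁ i+1≡j)         = step _ _ i+1≡j
  steps (inj₂ (i+1≡k , j≡0)) = wrap _ _ i+1≡k j≡0

-- The weighted count 2n₂ + n₁

weight : Graph n → (Fin n → Bool) → Fin n → ℕ
weight G W x = if W x then 0 else 2 ⊓ degIn G W x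

weight≤2 : (G : Graph n) (W : Fin n → Bool) (x : Fin n) → weight G W x ≤ 2
weight≤2 G W x with W x
... | true  = z≤n
... | false = m⊓n≤m 2 (degIn G W x)

weight≡2 : (G : Graph n) (W : Fin n → Bool) {x : Fin n} →
           W x ≡ false → 2 ≤ degIn G W x → weight G W x ≡ 2
weight≡2 G W Wx 2≤d rewrite Wx = m≤n⇒m⊓n≡m 2≤d

2n₂+n₁≡∑weight : (G : Graph n) (W : Fin n → Bool) (v : Fin n) →
                 2 * n₂ G W v + n₁ G W v ≡ ∑[ x < n ] (if isOther v x then weight G W x else 0)
2n₂+n₁≡∑weight {n} G W v = begin
  2 * count P₂ + count P₁                      ≡⟨ cong₂ (λ a b → 2 * a + b) (count≡∑ P₂) (count≡∑ P₁) ⟩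
  2 * ∑[ x < n ] 𝟙 (P₂ x) + ∑[ x < n ] 𝟙 (P₁ x) ≡⟨ cong (_+ ∑[ x < n ] 𝟙 (P₁ x)) (*-distribˡ-sum 2 (λ x → 𝟙 (P₂ x))) ⟩
  ∑[ x < n ] (2 * 𝟙 (P₂ x)) + ∑[ x < n ] 𝟙 (P₁ x) ≡⟨ ∑-distrib-+ (λ x → 2 * 𝟙 (P₂ x)) (λ x → 𝟙 (P₁ x)) ⟨
  ∑[ x < n ] (2 * 𝟙 (P₂ x) + 𝟙 (P₁ x))         ≡⟨ sum-cong-≗ pointwise ⟩
  ∑[ x < n ] (if isOther v x then weight G W x else 0) ∎
  where
  open ≡-Reasoning
  P₂ P₁ : Fin n → Bool
  P₂ x = if W x then false else if isOther v x then (2 ≤ᵇ degIn G W x) else false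
  P₁ x = if W x then false else if isOther v x then (degIn G W x ≡ᵇ 1) else false

  min2 : ∀ d → 2 * 𝟙 (2 ≤ᵇ d) + 𝟙 (d ≡ᵇ 1) ≡ 2 ⊓ d
  min2 zero          = refl
  min2 (suc zero)    = refl
  min2 (suc (suc d)) = refl

  pointwise : ∀ x → 2 * 𝟙 (P₂ x) + 𝟙 (P₁ x) ≡ (if isOther v x then weight G W x else 0)
  pointwise x with W x | isOther v x
  ... | true  | true  = refl
  ... | true  | false = refl
  ... | false | true  = min2 (degIn G W x)
  ... | false | false = refl

2n₂+n₁-antitone : (G : Graph n) (W : Fin n → Bool) {y w : Fin n} → weight G W w ≤ weight G W y →
                  2 * n₂ G W y + n₁ G W y ≤ 2 * n₂ G W w + n₁ G W w
2n₂+n₁-antitone {n} G W {y} {w} w≤y =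
  subst₂ _≤_ (sym (2n₂+n₁≡∑weight G W y)) (sym (2n₂+n₁≡∑weight G W w))
    (+-cancelʳ-≤ (weight G W w) _ _ (begin
      ∑-off y + weight G W w ≤⟨ +-monoʳ-≤ (∑-off y) w≤y ⟩
      ∑-off y + weight G W y ≡⟨ ∑-punctured (weight G W) y ⟩
      sum (weight G W)       ≡⟨ ∑-punctured (weight G W) w ⟨
      ∑-off w + weight G W w ∎))
  where
  open ℕ.≤-Reasoning
  ∑-off : Fin n → ℕ
  ∑-off a = ∑[ x < n ] (if isOther a x then weight G W x else 0)

-- Double counting edges between W and X - v

∧-true : {a b : Bool} → a ∧ b ≡ true → a ≡ true × b ≡ true
∧-true {true} b≡true = refl , b≡true

W-separates : (W : Fin n → Bool) {u x : Fin n} → W u ≡ true → W x ≡ false → u ≢ x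
W-separates W Wu Wx refl with () ← trans (sym Wu) Wx

double-counting-bound :
  (G : Graph n) (W : Fin n → Bool) → Independent G W → (v : Fin n) (E : Fin n → Fin n → Bool) →
  (∀ {u x} → E u x ≡ true → adj G u x ≡ true) → (∀ {u x} → E u x ≡ true → x ≢ v) →
  (∀ u → W u ≡ true → 2 ≤ count (E u)) →
  (∀ x → W x ≡ false → x ≢ v → count (λ u → W u ∧ E u x) ≤ 2) →
  2 * count W ≤ 2 * n₂ G W v + n₁ G W v
double-counting-bound {n} G W independent v E E⇒adj E-avoids rows columns = begin
  2 * count W                                            ≡⟨ cong (2 *_) (count≡∑ W) ⟩
  2 * ∑[ u < n ] 𝟙 (W u)                                 ≡⟨ *-distribˡ-sum 2 (λ u → 𝟙 (W u)) ⟩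
  ∑[ u < n ] (2 * 𝟙 (W u))                               ≤⟨ ∑-mono-≤ row ⟩
  ∑[ u < n ] count (λ x → W u ∧ E u x)                   ≡⟨ double-counting (λ u x → W u ∧ E u x) ⟩
  ∑[ x < n ] count (λ u → W u ∧ E u x)                   ≤⟨ ∑-mono-≤ column ⟩
  ∑[ x < n ] (if isOther v x then weight G W x else 0)   ≡⟨ 2n₂+n₁≡∑weight G W v ⟨
  2 * n₂ G W v + n₁ G W v                                ∎
  where
  open ℕ.≤-Reasoning

  row : ∀ u → 2 * 𝟙 (W u) ≤ count (λ x → W u ∧ E u x)
  row u with W u in Wu
  ... | false = z≤n
  ... | true  = rows u Wu

  no-partners : ∀ {x} → (∀ u → W u ∧ E u x ≡ false) → ∀ b → count (λ u → W u ∧ E u x) ≤ b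
  no-partners none b = subst (_≤ b) (sym (count-none _ none)) z≤n

  partner-in-W : ∀ {x} → W x ≡ true → ∀ u → W u ∧ E u x ≡ false
  partner-in-W {x} Wx u with W u in Wu | E u x in Eux
  ... | false | _     = refl
  ... | true  | false = refl
  ... | true  | true  with () ← trans (sym (E⇒adj Eux)) (independent u x Wu Wx)

  partner-is-v : ∀ u → W u ∧ E u v ≡ false
  partner-is-v u with E u v in Euv
  ... | true  = ⊥-elim (E-avoids Euv refl)
  ... | false = Bool.∧-zeroʳ (W u)

  column : ∀ x → count (λ u → W u ∧ E u x) ≤ (if isOther v x then weight G W x else 0)
  column x with W x in Wx | isOther v x in other
  ... | true  | _     = no-partners (partner-in-W Wx) _
  ... | false | false with isOther-false⇒≡ {a = v} {x} other
  ...   | refl = no-partners partner-is-v 0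
  column x | false | true = ⊓-glb (columns x Wx (isOther⇒≢ {a = v} other)) (count-mono _ _ toward-W)
    where
    toward-W : ∀ u → W u ∧ E u x ≡ true → (if W u then adj G x u else false) ≡ true
    toward-W u h with W u
    ... | true = trans (Graph.sym G x u) (E⇒adj h)

twoFactor-bound : (G : Graph n) (W : Fin n → Bool) → Independent G W → {v : Fin n} →
                  W v ≡ false → TwoFactorMinus G v → 2 * count W ≤ 2 * n₂ G W v + n₁ G W v
twoFactor-bound G W independent {v} Wv F =
  double-counting-bound G W independent v link link⇒adj link-avoids rows columns
  where
  open TwoFactorMinus F

  rows : ∀ u → W u ≡ true → 2 ≤ count (link u)
  rows u Wu with two-links u (W-separates W Wu Wv)
  ... | p , q , p≢q , up , uq = count-≥2 (link u) p q p≢q up uq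

  columns : ∀ x → W x ≡ false → x ≢ v → count (λ u → W u ∧ link u x) ≤ 2
  columns x _ x≢v =
    ≤-trans (count-mono (λ u → W u ∧ link u x) (link x) (λ u h → link-sym (proj₂ (∧-true h)))) (at-most-two-links x x≢v)

adjacent⇒≢ : (G : Graph n) {u x : Fin n} → adj G u x ≡ true → u ≢ x
adjacent⇒≢ G {u} ux refl with () ← trans (sym ux) (irref G u)

neighbour-avoiding : {G : Graph n} {y : Fin n} → TwoFactorMinus G y → {u : Fin n} → u ≢ y →
                     (w : Fin n) → ∃ λ r → r ≢ y × r ≢ w × adj G u r ≡ true
neighbour-avoiding {G = G} {y} F {u} u≢y w = choose (two-links u u≢y)
  where
  open TwoFactorMinus F
  choose : (∃₂ λ p q → p ≢ q × link u p ≡ true × link u q ≡ true) →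
           ∃ λ r → r ≢ y × r ≢ w × adj G u r ≡ true
  choose (p , q , p≢q , up , uq) with p ≟ w
  ... | no  p≢w  = p , link-avoids up , p≢w , link⇒adj up
  ... | yes refl = q , link-avoids uq , (λ q≡p → p≢q (sym q≡p)) , link⇒adj uq

two-neighbours-besides : {G : Graph n} {w : Fin n} → (∀ y → y ≢ w → TwoFactorMinus G y) →
                         {u y : Fin n} → y ≢ w → u ≢ y →
                         2 ≤ count (λ x → isOther w x ∧ adj G u x)
two-neighbours-besides {G = G} {w} factor {u} y≢w u≢y
  with neighbour-avoiding (factor _ y≢w) u≢y w
... | r , _ , r≢w , ur with neighbour-avoiding (factor r r≢w) (adjacent⇒≢ G ur) w
... | s , s≢r , s≢w , us =
  count-≥2 (λ x → isOther w x ∧ adj G u x) r s (λ r≡s → s≢r (sym r≡s)) (besides r≢w ur) (besides s≢w us)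
  where
  besides : ∀ {x} → x ≢ w → adj G u x ≡ true → isOther w x ∧ adj G u x ≡ true
  besides {x} x≢w ux = trans (cong (_∧ adj G u x) (isOther-≢ (λ w≡x → x≢w (sym w≡x)))) ux

small-degree-bound : (G : Graph n) (W : Fin n → Bool) → Independent G W → {w : Fin n} →
                     (∀ y → y ≢ w → TwoFactorMinus G y) → 1 < count (λ x → not (W x)) →
                     (∀ x → W x ≡ false → x ≢ w → degIn G W x ≤ 2) →
                     2 * count W ≤ 2 * n₂ G W w + n₁ G W w
small-degree-bound {n} G W independent {w} factor 1<|X| small =
  double-counting-bound G W independent w E E⇒adj E-avoids rows columns
  where
  E : Fin n → Fin n → Bool
  E u x = isOther w x ∧ adj G u x

  E⇒adj : ∀ {u x} → E u x ≡ true → adj G u x ≡ true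
  E⇒adj h = proj₂ (∧-true h)

  E-avoids : ∀ {u x} → E u x ≡ true → x ≢ w
  E-avoids {u} {x} h = isOther⇒≢ {a = w} {x} (proj₁ (∧-true h))

  rows : ∀ u → W u ≡ true → 2 ≤ count (E u)
  rows u Wu with exists-other (λ x → not (W x)) 1<|X| w
  ... | y , y≢w , y∈X =
    two-neighbours-besides factor y≢w (W-separates W Wu (Bool.not-injective y∈X))

  columns : ∀ x → W x ≡ false → x ≢ w → count (λ u → W u ∧ E u x) ≤ 2
  columns x Wx x≢w = ≤-trans (count-mono (λ u → W u ∧ E u x) _ toward-W) (small x Wx x≢w)
    where
    toward-W : ∀ u → W u ∧ E u x ≡ true → (if W u then adj G x u else false) ≡ true
    toward-W u h with W u
    ... | true = trans (Graph.sym G x u) (E⇒adj h)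

almostHypocyclic⇒twoFactors : {G : Graph n} {w : Fin n} → AlmostHypocyclic G w →
                              ∀ y → y ≢ w → TwoFactorMinus G y
almostHypocyclic⇒twoFactors (_ , hamiltonian) y y≢w = hamiltonian⇒twoFactor (hamiltonian y y≢w)

exceptional-bound : (G : Graph n) (W : Fin n → Bool) → Independent G W → {w : Fin n} →
                    (∀ y → y ≢ w → TwoFactorMinus G y) → 1 < count (λ x → not (W x)) →
                    2 * count W ≤ 2 * n₂ G W w + n₁ G W w
exceptional-bound G W independent {w} factor 1<|X|
  with any? (λ y → (W y Bool.≟ false) ×-dec ¬? (y ≟ w) ×-dec (2 ℕ.≤? degIn G W y))
... | yes (y , Wy , y≢w , 2≤d) =
  ≤-trans (twoFactor-bound G W independent Wy (factor y y≢w))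
          (2n₂+n₁-antitone G W (subst (weight G W w ≤_) (sym (weight≡2 G W Wy 2≤d)) (weight≤2 G W w)))
... | no none = small-degree-bound G W independent factor 1<|X| small
  where
  small : ∀ x → W x ≡ false → x ≢ w → degIn G W x ≤ 2
  small x Wx x≢w = <⇒≤ (≰⇒> (λ 2≤d → none (x , Wx , x≢w , 2≤d)))

lemma3p2 : (n : ℕ) (G : Graph n) (w : Fin n) → AlmostHypocyclic G w →
           (W : Fin n → Bool) → Independent G W →
           1 < count W → 1 < count (λ x → not (W x)) →
           (v : Fin n) → W v ≡ false →
           2 * count W ≤ 2 * n₂ G W v + n₁ G W v
lemma3p2 n G w hypocyclic W independent _ 1<|X| v Wv with v ≟ w
... | no  v≢w  = twoFactor-bound G W independent Wv (almostHypocyclic⇒twoFactors hypocyclic v v≢w)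
... | yes refl = exceptional-bound G W independent (almostHypocyclic⇒twoFactors hypocyclic) 1<|X|
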